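{- Let $k\ge 2$ and $d\ge (k+2)^2$ be integers, and let $s\in\{k,k+1,\ldots,d\}$. Then $K(d+1,k,s)\ge K(d,k)$.
   Context: Let $I(d)$ denote the graph of the $d$-dimensional hypercube. For an integer $k\ge 1$, a $(d,k)$ circuit code is a simple cycle $C$ in $I(d)$ such that $d_{I(d)}(x,y)\ge \min\{d_C(x,y),k\}$ for all vertices $x,y$ of $C$, where $d_{I(d)}$ is the Hamming distance and $d_C$ is the graph distance along $C$. $K(d,k)$ denotes the maximum length of a $(d,k)$ circuit code, and $K(d,k,s)$ denotes the maximum length of a $(d,k)$ circuit code whose length is divisible by $s$. -}

module Defs where

open import Data.Nat using (ℕ; zero; suc; _+_; _∸_; _⊓_; _≤_; ∣_-_∣)
open import Data.Bool using (Bool; true; false)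
open import Data.Vec using (Vec; []; _∷_)
open import Data.Fin using (Fin; toℕ)
open import Data.Product using (_×_)
open import Relation.Binary.PropositionalEquality using (_≡_)
open import Function.Definitions using (Injective)

Vertex : ℕ → Set
Vertex d = Vec Bool d

differ : Bool → Bool → ℕ
differ true  true  = 0
differ false false = 0
differ _     _     = 1

-- Hamming distance = graph distance in I(d).
hamming : ∀ {d} → Vertex d → Vertex d → ℕ
hamming []       []       = 0
hamming (x ∷ xs) (y ∷ ys) = differ x y + hamming xs ys

cycDist : ∀ {n} → Fin n → Fin n → ℕ
cycDist {n} i j = ∣ toℕ i - toℕ j ∣ ⊓ (n ∸ ∣ toℕ i - toℕ j ∣)

IsSimpleCycle : (d n : ℕ) → (Fin n → Vertex d) → Set
IsSimpleCycle d n c =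
  (3 ≤ n) × Injective _≡_ _≡_ c ×
  (∀ i j → cycDist i j ≡ 1 → hamming (c i) (c j) ≡ 1)

IsCircuitCode : (d k n : ℕ) → (Fin n → Vertex d) → Set
IsCircuitCode d k n c =
  IsSimpleCycle d n c ×
  (∀ i j → cycDist i j ⊓ k ≤ hamming (c i) (c j))

{-# OPTIONS --safe #-}
-- Unroll a (d,k) circuit code of length L into an L-periodic walk in I(d). A new coordinate is
-- added by following the old walk and flipping the new coordinate 2q times per period, with at
-- least k old steps between consecutive flips. This gives a (d+1,k) circuit code of length L + 2q
-- whenever 2kq ≤ L: a window of fewer than k old steps contains at most one flip, so the new
-- coordinate makes up for the single step the window is stretched by, and any other window
-- already spans at least k on the old coordinates. Every step flips the parity of the vertex, so
-- L = 2h is even, and choosing q < s with s ∣ h + q makes the new length divisible by s. This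
-- needs 2ks ≤ L; a shorter given code is replaced by one of length at least 2kd in I(d), grown
-- from the isometric 2k-cycle in I(k) by repeated insertions, which is where d ≥ (k+2)² is used.
module Submission where

open import Defs
open import Data.Nat hiding (parity)
open import Data.Nat.Properties
open import Data.Nat.DivMod
open import Data.Nat.Divisibility using (_∣_; divides; ∣m∣n⇒∣m+n; ∣-refl)
open import Data.Nat.GeneralisedArithmetic using (iterate)
open import Data.Nat.Tactic.RingSolver using (solve-∀)
open import Data.Bool using (Bool; true; false; not; _xor_)
open import Data.Bool.Properties using (not-involutive)
open import Data.Vec using ([]; _∷_)
open import Data.Fin using (Fin; toℕ)
open import Data.Fin.Properties using (toℕ-fromℕ<; toℕ-injective; toℕ<n)
open import Data.Product using (Σ; ∃-syntax; _×_; _,_)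
open import Data.Sum using (_⊎_; inj₁; inj₂)
open import Data.Empty using (⊥-elim)
open import Relation.Nullary using (Dec; yes; no)
open import Relation.Binary.PropositionalEquality

differ-refl : ∀ b → differ b b ≡ 0
differ-refl true  = refl
differ-refl false = refl

differ-not : ∀ b → differ b (not b) ≡ 1
differ-not true  = refl
differ-not false = refl

differ-sym : ∀ a b → differ a b ≡ differ b a
differ-sym true  true  = refl
differ-sym true  false = refl
differ-sym false true  = refl
differ-sym false false = refl

hamming-refl : ∀ {d} (x : Vertex d) → hamming x x ≡ 0
hamming-refl []       = refl
hamming-refl (a ∷ x) = cong₂ _+_ (differ-refl a) (hamming-refl x)

hamming-sym : ∀ {d} (x y : Vertex d) → hamming x y ≡ hamming y x
hamming-sym []       []       = refl
hamming-sym (a ∷ x) (b ∷ y) = cong₂ _+_ (differ-sym a b) (hamming-sym x y)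

hamming≡0⇒≡ : ∀ {d} (x y : Vertex d) → hamming x y ≡ 0 → x ≡ y
hamming≡0⇒≡ []           []           _ = refl
hamming≡0⇒≡ (true ∷ x)  (true ∷ y)  e = cong (true ∷_) (hamming≡0⇒≡ x y e)
hamming≡0⇒≡ (false ∷ x) (false ∷ y) e = cong (false ∷_) (hamming≡0⇒≡ x y e)

parity : ∀ {d} → Vertex d → Bool
parity []       = false
parity (b ∷ x) = b xor parity x

parity-adjacent : ∀ {d} (x y : Vertex d) → hamming x y ≡ 1 → parity y ≡ not (parity x)
parity-adjacent []          []          ()
parity-adjacent (true ∷ x)  (true ∷ y)  e = cong not (parity-adjacent x y e)
parity-adjacent (false ∷ x) (false ∷ y) e = parity-adjacent x y e
parity-adjacent (true ∷ x)  (false ∷ y) e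
  rewrite hamming≡0⇒≡ x y (suc-injective e) = sym (not-involutive (parity y))
parity-adjacent (false ∷ x) (true ∷ y)  e
  rewrite hamming≡0⇒≡ x y (suc-injective e) = refl

module _ {A : Set} (f : A → A) where

  iterate-+ : ∀ x m n → iterate f x (m + n) ≡ iterate f (iterate f x m) n
  iterate-+ x zero    n = refl
  iterate-+ x (suc m) n = iterate-+ (f x) m n

  iterate-suc : ∀ x n → iterate f x (suc n) ≡ f (iterate f x n)
  iterate-suc x zero    = refl
  iterate-suc x (suc n) = iterate-suc (f x) n

  iterate-commute : ∀ {h : A → A} → (∀ x → f (h x) ≡ h (f x)) →
                    ∀ x n → iterate f (h x) n ≡ h (iterate f x n)
  iterate-commute comm x zero    = refl
  iterate-commute comm x (suc n) =
    trans (cong (λ y → iterate f y n) (comm x)) (iterate-commute comm (f x) n)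

iterate-not-even : ∀ h b → iterate not b (h + h) ≡ b
iterate-not-even zero    b = refl
iterate-not-even (suc h) b rewrite +-suc h h =
  trans (iterate-not-even h (not (not b))) (not-involutive b)

iterate-not-fixed⇒even : ∀ n b → iterate not b n ≡ b → ∃[ h ] n ≡ h + h
iterate-not-fixed⇒even zero          b     _ = 0 , refl
iterate-not-fixed⇒even (suc zero)    true  ()
iterate-not-fixed⇒even (suc zero)    false ()
iterate-not-fixed⇒even (suc (suc n)) b     e
  with iterate-not-fixed⇒even n b (trans (cong (λ c → iterate not c n) (sym (not-involutive b))) e)
... | h , refl = suc h , cong suc (sym (+-suc h h))

-- A (D,K) circuit code of length L, unrolled into an L-periodic walk; a ⊓ (L ∸ a) is the
-- distance along the cycle between positions i and i + a.
record Code (D K L : ℕ) : Set where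
  field
    walk     : ℕ → Vertex D
    periodic : ∀ p → walk (L + p) ≡ walk p
    adjacent : ∀ p → hamming (walk p) (walk (suc p)) ≡ 1
    spread   : ∀ i a → a ≤ L → a ⊓ (L ∸ a) ⊓ K ≤ hamming (walk i) (walk (i + a))

pad : ∀ {D K L} → Code D K L → Code (suc D) K L
pad C = record
  { walk     = λ p → false ∷ walk p
  ; periodic = λ p → cong (false ∷_) (periodic p)
  ; adjacent = adjacent
  ; spread   = spread
  }
  where open Code C

weaken : ∀ {D K K′ L} → K ≤ K′ → Code D K′ L → Code D K L
weaken K≤K′ C = record
  { walk     = walk
  ; periodic = periodic
  ; adjacent = adjacent
  ; spread   = λ i a a≤L → ≤-trans (⊓-monoʳ-≤ _ K≤K′) (spread i a a≤L)
  }
  where open Code C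

module _ {D K L : ℕ} (C : Code D K L) where
  open Code C

  spread-short : K + K ≤ L → ∀ i b → b < K → b ≤ hamming (walk i) (walk (i + b))
  spread-short 2K≤L i b b<K = subst (_≤ hamming (walk i) (walk (i + b))) b-min (spread i b b≤L)
    where
    b≤K : b ≤ K
    b≤K = <⇒≤ b<K
    b≤L∸b : b ≤ L ∸ b
    b≤L∸b = m+n≤o⇒m≤o∸n b (≤-trans (+-mono-≤ b≤K b≤K) 2K≤L)
    b≤L : b ≤ L
    b≤L = ≤-trans b≤L∸b (m∸n≤m L b)
    b-min : b ⊓ (L ∸ b) ⊓ K ≡ b
    b-min = trans (cong (_⊓ K) (m≤n⇒m⊓n≡m b≤L∸b)) (m≤n⇒m⊓n≡m b≤K)

  spread-long : ∀ i b → b ≤ L → K ≤ b → K ≤ L ∸ b → K ≤ hamming (walk i) (walk (i + b))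
  spread-long i b b≤L K≤b K≤L∸b = subst (_≤ hamming (walk i) (walk (i + b)))
                                        (m≥n⇒m⊓n≡n (⊓-glb K≤b K≤L∸b)) (spread i b b≤L)

  length-even : ∃[ h ] L ≡ h + h
  length-even =
    iterate-not-fixed⇒even L _ (trans (sym (parity-walk L)) (cong parity walk-L≡walk-0))
    where
    parity-walk : ∀ p → parity (walk p) ≡ iterate not (parity (walk 0)) p
    parity-walk zero    = refl
    parity-walk (suc p) = begin
      parity (walk (suc p))
        ≡⟨ parity-adjacent (walk p) (walk (suc p)) (adjacent p) ⟩
      not (parity (walk p))                  ≡⟨ cong not (parity-walk p) ⟩
      not (iterate not (parity (walk 0)) p)  ≡⟨ iterate-suc not _ p ⟨
      iterate not (parity (walk 0)) (suc p)  ∎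
      where open ≡-Reasoning
    walk-L≡walk-0 : walk L ≡ walk 0
    walk-L≡walk-0 = trans (cong walk (sym (+-identityʳ L))) (periodic 0)

-- The walk that inserts flips of a new coordinate into an old walk: g old steps, a flip,
-- and then 2n+1 times K old steps and a flip, so that 2n+2 flips occur per period. A state
-- holds the old position, the new coordinate, the old steps left before the next flip and the
-- number of K-gaps still to come in the current period.
module Insertion (K g n : ℕ) where

  record State : Set where
    constructor ⟨_,_,_,_⟩
    field
      old  : ℕ
      bit  : Bool
      left : ℕ
      gaps : ℕ

  open State public

  nextGap remainingGaps : ℕ → ℕ
  nextGap zero    = g
  nextGap (suc j) = K
  remainingGaps zero    = suc (n + n)
  remainingGaps (suc j) = j

  step : State → State
  step ⟨ o , b , suc r , j ⟩ = ⟨ suc o , b , r , j ⟩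
  step ⟨ o , b , zero  , j ⟩ = ⟨ o , not b , nextGap j , remainingGaps j ⟩

  start : State
  start = ⟨ 0 , false , g , suc (n + n) ⟩

  state : ℕ → State
  state = iterate step start

  oldLength newLength : ℕ
  oldLength = g + suc (n + n) * K
  newLength = oldLength + (suc n + suc n)

  shift : State → State
  shift ⟨ o , b , r , j ⟩ = ⟨ o + oldLength , b , r , j ⟩

  step-shift : ∀ s → step (shift s) ≡ shift (step s)
  step-shift ⟨ o , b , suc r , j ⟩ = refl
  step-shift ⟨ o , b , zero  , j ⟩ = refl

  data _↝_ (s t : State) : Set where
    move : old t ≡ suc (old s) → bit t ≡ bit s → s ↝ t
    flip : old t ≡ old s → bit t ≡ not (bit s) → s ↝ t

  step-↝ : ∀ s → s ↝ step s
  step-↝ ⟨ o , b , suc r , j ⟩ = move refl refl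
  step-↝ ⟨ o , b , zero  , j ⟩ = flip refl refl

  old-mono : ∀ a s → old s ≤ old (iterate step s a)
  old-mono zero    s = ≤-refl
  old-mono (suc a) s with step s | step-↝ s
  ... | t | move eq _ = ≤-trans (≤-trans (n≤1+n _) (≤-reflexive (sym eq))) (old-mono a t)
  ... | t | flip eq _ = ≤-trans (≤-reflexive (sym eq)) (old-mono a t)

  moves+flips : ∀ a s → let t = iterate step s a in
                ∃[ e ] old t + e ≡ old s + a × bit t ≡ iterate not (bit s) e
  moves+flips zero    s = 0 , refl , refl
  moves+flips (suc a) s with step s | step-↝ s | moves+flips a (step s)
  ... | t | move eo eb | e , p , q =
    e , trans p (trans (cong (_+ a) eo) (sym (+-suc _ a))) ,
    trans q (cong (λ b → iterate not b e) eb)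
  ... | t | flip eo eb | e , p , q =
    suc e , trans (+-suc _ e) (trans (cong suc (trans p (cong (_+ a) eo))) (sym (+-suc _ a))) ,
    trans q (cong (λ b → iterate not b e) eb)

  run-gap : ∀ o b r j → iterate step ⟨ o , b , r , j ⟩ r ≡ ⟨ o + r , b , 0 , j ⟩
  run-gap o b zero    j = cong (λ o′ → ⟨ o′ , b , 0 , j ⟩) (sym (+-identityʳ o))
  run-gap o b (suc r) j =
    trans (run-gap (suc o) b r j) (cong (λ o′ → ⟨ o′ , b , 0 , j ⟩) (sym (+-suc o r)))

  run-gaps : ∀ o b j →
             iterate step ⟨ o , b , 0 , j ⟩ (j * suc K) ≡ ⟨ o + j * K , iterate not b j , 0 , 0 ⟩
  run-gaps o b zero    = cong (λ o′ → ⟨ o′ , b , 0 , 0 ⟩) (sym (+-identityʳ o))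
  run-gaps o b (suc j) = begin
    iterate step ⟨ o , not b , K , j ⟩ (K + j * suc K)
      ≡⟨ iterate-+ step _ K (j * suc K) ⟩
    iterate step (iterate step ⟨ o , not b , K , j ⟩ K) (j * suc K)
      ≡⟨ cong (λ s → iterate step s (j * suc K)) (run-gap o (not b) K j) ⟩
    iterate step ⟨ o + K , not b , 0 , j ⟩ (j * suc K)
      ≡⟨ run-gaps (o + K) (not b) j ⟩
    ⟨ o + K + j * K , iterate not (not b) j , 0 , 0 ⟩
      ≡⟨ cong (λ o′ → ⟨ o′ , iterate not (not b) j , 0 , 0 ⟩) (+-assoc o K (j * K)) ⟩
    ⟨ o + (K + j * K) , iterate not (not b) j , 0 , 0 ⟩ ∎
    where open ≡-Reasoning

  period : state newLength ≡ shift start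
  period = begin
    iterate step start newLength
      ≡⟨ cong (iterate step start) newLength≡ ⟩
    iterate step start (g + (m * suc K + 1))
      ≡⟨ iterate-+ step start g _ ⟩
    iterate step (iterate step start g) (m * suc K + 1)
      ≡⟨ cong (λ s → iterate step s (m * suc K + 1)) (run-gap 0 false g m) ⟩
    iterate step ⟨ g , false , 0 , m ⟩ (m * suc K + 1)
      ≡⟨ iterate-+ step ⟨ g , false , 0 , m ⟩ (m * suc K) 1 ⟩
    step (iterate step ⟨ g , false , 0 , m ⟩ (m * suc K))
      ≡⟨ cong step (run-gaps g false m) ⟩
    ⟨ oldLength , not (iterate not true (n + n)) , g , m ⟩
      ≡⟨ cong (λ b → ⟨ oldLength , not b , g , m ⟩) (iterate-not-even n true) ⟩
    shift start ∎
    where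
    open ≡-Reasoning
    m = suc (n + n)
    newLength≡ : newLength ≡ g + (m * suc K + 1)
    newLength≡ = identity g n K
      where
      identity : ∀ g n K → g + suc (n + n) * K + (suc n + suc n) ≡ g + (suc (n + n) * suc K + 1)
      identity = solve-∀

  state-periodic : ∀ p → state (newLength + p) ≡ shift (state p)
  state-periodic p = begin
    state (newLength + p)             ≡⟨ iterate-+ step start newLength p ⟩
    iterate step (state newLength) p  ≡⟨ cong (λ s → iterate step s p) period ⟩
    iterate step (shift start) p      ≡⟨ iterate-commute step step-shift start p ⟩
    shift (state p)                   ∎
    where open ≡-Reasoning

  -- Consecutive flips are at least K old steps apart, so a window of fewer than K old steps
  -- contains at most one flip.
  data Window (s : State) : ℕ → State → Set where
    unflipped : ∀ {a t} → old t ≡ old s + a → bit t ≡ bit s → Window s a t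
    flipped   : ∀ {b t} → old t ≡ old s + b → bit t ≡ not (bit s) → K ≤ b + left t →
                Window s (suc b) t
    far       : ∀ {a t} → old s + K ≤ old t → Window s a t

  module _ (K≤g : K ≤ g) where

    K≤nextGap : ∀ j → K ≤ nextGap j
    K≤nextGap zero    = K≤g
    K≤nextGap (suc j) = ≤-refl

    window-step : ∀ {s a} t → Window s a t → Window s (suc a) (step t)
    window-step {s} {a} ⟨ o , b , suc r , j ⟩ (unflipped p q) =
      unflipped (trans (cong suc p) (sym (+-suc (old s) a))) q
    window-step {s} ⟨ o , b , suc r , j ⟩ (flipped {b′} p q gap) =
      flipped (trans (cong suc p) (sym (+-suc (old s) b′))) q (subst (K ≤_) (+-suc b′ r) gap)
    window-step ⟨ o , b , suc r , j ⟩ (far p) = far (m≤n⇒m≤1+n p)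
    window-step {s} {a} ⟨ o , b , zero , j ⟩ (unflipped p q) =
      flipped p (cong not q) (≤-trans (K≤nextGap j) (m≤n+m _ a))
    window-step {s} ⟨ o , b , zero , j ⟩ (flipped {b′} p q gap) =
      far (subst (old s + K ≤_) (sym p) (+-monoʳ-≤ (old s) (subst (K ≤_) (+-identityʳ b′) gap)))
    window-step ⟨ o , b , zero , j ⟩ (far p) = far p

    window : ∀ a s → Window s a (iterate step s a)
    window zero    s = unflipped (sym (+-identityʳ (old s))) refl
    window (suc a) s = subst (Window s (suc a)) (sym (iterate-suc step s a))
                             (window-step (iterate step s a) (window a s))

    short-window : ∀ a s → let t = iterate step s a in old t < old s + K →
      ∃[ b ] old t ≡ old s + b × (a ≡ b × bit t ≡ bit s ⊎ a ≡ suc b × bit t ≡ not (bit s))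
    short-window a s close with window a s
    ... | unflipped p q       = a , p , inj₁ (refl , q)
    ... | flipped {b} p q _   = b , p , inj₂ (refl , q)
    ... | far p               = ⊥-elim (<⇒≱ close p)

module Extension {D K g n : ℕ} (K≤g : K ≤ g) (C : Code D K (Insertion.oldLength K g n)) where
  open Insertion K g n
  open Code C public

  lift : State → Vertex (suc D)
  lift s = bit s ∷ walk (old s)

  lift-shift : ∀ s → lift (shift s) ≡ lift s
  lift-shift ⟨ o , b , r , j ⟩ = cong (b ∷_) (trans (cong walk (+-comm o oldLength)) (periodic o))

  lift-↝ : ∀ {s t} → s ↝ t → hamming (lift s) (lift t) ≡ 1
  lift-↝ {s} (move eo eb) =
    cong₂ _+_ (trans (cong (differ (bit s)) eb) (differ-refl (bit s)))
              (trans (cong (λ o → hamming (walk (old s)) (walk o)) eo) (adjacent (old s)))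
  lift-↝ {s} (flip eo eb) =
    cong₂ _+_ (trans (cong (differ (bit s)) eb) (differ-not (bit s)))
              (trans (cong (λ o → hamming (walk (old s)) (walk o)) eo) (hamming-refl (walk (old s))))

  lift-short : ∀ a s → let t = iterate step s a in
               old t < old s + K → a ≤ hamming (lift s) (lift t)
  lift-short a s close = bound (short-window K≤g a s close)
    where
    t = iterate step s a
    H = hamming (walk (old s)) (walk (old t))
    walk-short : ∀ b → old t ≡ old s + b → b ≤ H
    walk-short b p = subst (λ o → b ≤ hamming (walk (old s)) (walk o)) (sym p)
      (spread-short C (+-mono-≤ K≤g (m≤m+n K _)) (old s) b
                    (+-cancelˡ-< (old s) b K (subst (_< old s + K) p close)))
    bound : ∃[ b ] old t ≡ old s + b ×
                   (a ≡ b × bit t ≡ bit s ⊎ a ≡ suc b × bit t ≡ not (bit s)) →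
            a ≤ differ (bit s) (bit t) + H
    bound (b , p , inj₁ (a≡b , _)) =
      subst (_≤ differ (bit s) (bit t) + H) (sym a≡b) (≤-trans (walk-short b p) (m≤n+m H _))
    bound (b , p , inj₂ (a≡1+b , q)) =
      subst₂ (λ x y → x ≤ y + H) (sym a≡1+b) differ≡1 (s≤s (walk-short b p))
      where
      differ≡1 : 1 ≡ differ (bit s) (bit t)
      differ≡1 = sym (trans (cong (differ (bit s)) q) (differ-not (bit s)))

  FarApart : State → State → Set
  FarApart s t = ∃[ b ] old t ≡ old s + b × b ≤ oldLength × K ≤ b × K ≤ oldLength ∸ b

  walk-far : ∀ s t → FarApart s t → K ≤ hamming (walk (old s)) (walk (old t))
  walk-far s t (b , p , b≤L , K≤b , K≤L∸b) =
    subst (λ o → K ≤ hamming (walk (old s)) (walk o)) (sym p)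
          (spread-long C (old s) b b≤L K≤b K≤L∸b)

  lift-spread : ∀ i a → a ≤ newLength →
    let s = state i ; t = iterate step s a ; H = hamming (lift s) (lift t) in
    a ≤ H ⊎ newLength ∸ a ≤ H ⊎ FarApart s t
  lift-spread i a a≤ = cases (old t <? old s + K) (old u <? old t + K)
    where
    s = state i
    t = iterate step s a
    u = iterate step t (newLength ∸ a)
    H = hamming (lift s) (lift t)
    u≡ : u ≡ shift s
    u≡ = begin
      iterate step t (newLength ∸ a)   ≡⟨ iterate-+ step s a (newLength ∸ a) ⟨
      iterate step s (a + (newLength ∸ a)) ≡⟨ cong (iterate step s) (m+[n∸m]≡n a≤) ⟩
      iterate step s newLength         ≡⟨ iterate-+ step start i newLength ⟨
      state (i + newLength)            ≡⟨ cong state (+-comm i newLength) ⟩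
      state (newLength + i)            ≡⟨ state-periodic i ⟩
      shift s                          ∎
      where open ≡-Reasoning
    b = old t ∸ old s
    t≡ : old t ≡ old s + b
    t≡ = sym (m+[n∸m]≡n (old-mono a s))
    cases : Dec (old t < old s + K) → Dec (old u < old t + K) →
            a ≤ H ⊎ newLength ∸ a ≤ H ⊎ FarApart s t
    cases (yes close) _ = inj₁ (lift-short a s close)
    cases (no _) (yes close) =
      inj₂ (inj₁ (subst (newLength ∸ a ≤_) back (lift-short (newLength ∸ a) t close)))
      where
      back : hamming (lift t) (lift u) ≡ H
      back = trans (cong (λ v → hamming (lift t) (lift v)) u≡)
                   (trans (cong (hamming (lift t)) (lift-shift s)) (hamming-sym (lift t) (lift s)))
    cases (no far₁) (no far₂) = inj₂ (inj₂ (b , t≡ , b≤L , K≤b , m+n≤o⇒m≤o∸n K K+b≤L))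
      where
      open ≤-Reasoning
      b≤L : b ≤ oldLength
      b≤L = +-cancelˡ-≤ (old s) b oldLength
              (subst₂ _≤_ t≡ (cong old u≡) (old-mono (newLength ∸ a) t))
      K≤b : K ≤ b
      K≤b = +-cancelˡ-≤ (old s) K b (subst (old s + K ≤_) t≡ (≮⇒≥ far₁))
      K+b≤L : K + b ≤ oldLength
      K+b≤L = +-cancelˡ-≤ (old s) (K + b) oldLength (begin
        old s + (K + b)   ≡⟨ cong (old s +_) (+-comm K b) ⟩
        old s + (b + K)   ≡⟨ +-assoc (old s) b K ⟨
        old s + b + K     ≡⟨ cong (_+ K) t≡ ⟨
        old t + K         ≤⟨ ≮⇒≥ far₂ ⟩
        old u             ≡⟨ cong old u≡ ⟩
        old s + oldLength ∎)

  lifted : ∀ {K′} → (∀ i a → a ≤ newLength → let s = state i in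
             a ⊓ (newLength ∸ a) ⊓ K′ ≤ hamming (lift s) (lift (iterate step s a))) →
           Code (suc D) K′ newLength
  lifted spread′ = record
    { walk     = λ p → lift (state p)
    ; periodic = λ p → trans (cong lift (state-periodic p)) (lift-shift (state p))
    ; adjacent = λ p → subst (λ t → hamming (lift (state p)) (lift t) ≡ 1)
                             (sym (iterate-suc step start p)) (lift-↝ (step-↝ (state p)))
    ; spread   = λ i a a≤ → subst (λ t → _ ≤ hamming (lift (state i)) (lift t))
                                  (sym (iterate-+ step start i a)) (spread′ i a a≤)
    }

extend : ∀ {D K L} n → Code D K L → suc n * (K + K) ≤ L → Code (suc D) K (L + (suc n + suc n))
extend {D} {K} {L} n C long =
  subst (λ L′ → Code (suc D) K (L′ + (suc n + suc n))) oldLength≡L (lifted spread′)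
  where
  m = suc (n + n)
  g = L ∸ m * K
  mK+K≤L : m * K + K ≤ L
  mK+K≤L = subst (_≤ L) (identity n K) long
    where
    identity : ∀ n K → suc n * (K + K) ≡ suc (n + n) * K + K
    identity = solve-∀
  oldLength≡L : Insertion.oldLength K g n ≡ L
  oldLength≡L = m∸n+n≡m (m+n≤o⇒m≤o (m * K) mK+K≤L)
  K≤g : K ≤ g
  K≤g = m+n≤o⇒m≤o∸n K (subst (_≤ L) (+-comm (m * K) K) mK+K≤L)
  open Insertion K g n
  open Extension {n = n} K≤g (subst (Code D K) (sym oldLength≡L) C)
  spread′ : ∀ i a → a ≤ newLength →
            a ⊓ (newLength ∸ a) ⊓ K ≤ hamming (lift (state i)) (lift (iterate step (state i) a))
  spread′ i a a≤ with lift-spread i a a≤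
  ... | inj₁ a≤H         = ≤-trans (m⊓n≤m _ K) (≤-trans (m⊓n≤m a _) a≤H)
  ... | inj₂ (inj₁ a′≤H) = ≤-trans (m⊓n≤m _ K) (≤-trans (m⊓n≤n a _) a′≤H)
  ... | inj₂ (inj₂ apart) = ≤-trans (m⊓n≤n _ K)
    (≤-trans (walk-far (state i) (iterate step (state i) a) apart) (m≤n+m _ _))

module IsometricStep {D K : ℕ} (C : Code D (K + K) (K + K)) where
  open Insertion K K 0

  K+K≡oldLength : K + K ≡ oldLength
  K+K≡oldLength = cong (K +_) (sym (+-identityʳ K))

  open Extension {n = 0} ≤-refl (subst (Code D K) K+K≡oldLength (weaken (m≤m+n K K) C))

  -- t lies exactly K old steps after s, and the number e of flips in between decides
  -- on which half of the cycle t lies.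
  far-spread : ∀ s a → let t = iterate step s a in
               FarApart s t → a ⊓ (newLength ∸ a) ≤ hamming (lift s) (lift t)
  far-spread s a apart@(b , p , b≤L , K≤b , K≤L∸b) with moves+flips a s
  ... | e , q , r = by-flips e a≡K+e r
    where
    t = iterate step s a
    Hw = hamming (walk (old s)) (walk (old t))
    K≤Hw : K ≤ Hw
    K≤Hw = walk-far s t apart
    b≡K : b ≡ K
    b≡K = ≤-antisym (subst (b ≤_) (+-identityʳ K)
                           (+-cancelˡ-≤ K b (K + 0) (m≤o∸n⇒m+n≤o K b≤L K≤L∸b))) K≤b
    a≡K+e : a ≡ K + e
    a≡K+e = +-cancelˡ-≡ (old s) a (K + e) (begin
      old s + a        ≡⟨ q ⟨
      old t + e        ≡⟨ cong (_+ e) (trans p (cong (old s +_) b≡K)) ⟩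
      old s + K + e    ≡⟨ +-assoc (old s) K e ⟩
      old s + (K + e)  ∎)
      where open ≡-Reasoning
    by-flips : ∀ e → a ≡ K + e → bit t ≡ iterate not (bit s) e →
               a ⊓ (newLength ∸ a) ≤ differ (bit s) (bit t) + Hw
    by-flips zero a≡K _ = ≤-trans (m⊓n≤m a _)
      (≤-trans (≤-reflexive (trans a≡K (+-identityʳ K))) (≤-trans K≤Hw (m≤n+m Hw _)))
    by-flips (suc zero) a≡K+1 bit-flipped = ≤-trans (m⊓n≤m a _)
      (subst₂ (λ x y → x ≤ y + Hw) (sym (trans a≡K+1 (+-comm K 1)))
              (sym (trans (cong (differ (bit s)) bit-flipped) (differ-not (bit s)))) (s≤s K≤Hw))
    by-flips (suc (suc e)) a≡K+2+e _ = ≤-trans (m⊓n≤n a _)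
      (≤-trans (m≤n+o⇒m∸n≤o newLength a newLength≤a+K) (≤-trans K≤Hw (m≤n+m Hw _)))
      where
      identity : ∀ K → K + 2 + K ≡ K + suc (0 + 0) * K + (1 + 1)
      identity = solve-∀
      newLength≤a+K : newLength ≤ a + K
      newLength≤a+K = subst₂ _≤_ (identity K) (cong (_+ K) (sym a≡K+2+e))
                             (+-monoˡ-≤ K (+-monoʳ-≤ K (s≤s (s≤s (z≤n {e})))))

  code : Code (suc D) newLength newLength
  code = lifted λ i a a≤ → ≤-trans (m⊓n≤m _ newLength) (cases {i} {a} (lift-spread i a a≤))
    where
    cases : ∀ {i a} → let s = state i ; t = iterate step s a ; H = hamming (lift s) (lift t) in
            a ≤ H ⊎ newLength ∸ a ≤ H ⊎ FarApart s t → a ⊓ (newLength ∸ a) ≤ H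
    cases {a = a} (inj₁ a≤H)         = ≤-trans (m⊓n≤m a _) a≤H
    cases {a = a} (inj₂ (inj₁ a′≤H)) = ≤-trans (m⊓n≤n a _) a′≤H
    cases {i} {a} (inj₂ (inj₂ apart)) = far-spread (state i) a apart

isometric-step : ∀ {D K} → Code D (K + K) (K + K) → Code (suc D) (suc K + suc K) (suc K + suc K)
isometric-step {D} {K} C = subst (λ N → Code (suc D) N N) (newLength≡ K) (IsometricStep.code {K = K} C)
  where
  newLength≡ : ∀ K → K + suc (0 + 0) * K + (1 + 1) ≡ suc K + suc K
  newLength≡ = solve-∀

isometric : ∀ N → Code (suc N) (suc N + suc N) (suc N + suc N)
isometric zero = record
  { walk     = alternating
  ; periodic = λ p → refl
  ; adjacent = adjacent
  ; spread   = spread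
  }
  where
  alternating : ℕ → Vertex 1
  alternating p = iterate not false p ∷ []
  adjacent : ∀ p → hamming (alternating p) (alternating (suc p)) ≡ 1
  adjacent p = cong (_+ 0) (trans (cong (differ (iterate not false p)) (iterate-suc not false p))
                                  (differ-not _))
  spread : ∀ i a → a ≤ 2 → a ⊓ (2 ∸ a) ⊓ 2 ≤ hamming (alternating i) (alternating (i + a))
  spread i 0 _ = z≤n
  spread i 1 _ = subst (λ j → 1 ≤ hamming (alternating i) (alternating j)) (+-comm 1 i)
                       (≤-reflexive (sym (adjacent i)))
  spread i 2 _ = z≤n
  spread i (suc (suc (suc a))) (s≤s (s≤s ()))
isometric (suc N) = isometric-step {K = suc N} (isometric N)

extend-or-pad : ∀ {D K L} q → Code D K L → q * (K + K) ≤ L → Code (suc D) K (L + (q + q))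
extend-or-pad {L = L} zero    C _    = subst (Code _ _) (sym (+-identityʳ L)) (pad C)
extend-or-pad         (suc n) C long = extend n C long

extend-repeatedly : ∀ {D K L} A j → Code D K L → A * (K + K) ≤ L →
                    ∃[ L′ ] Code (j + D) K L′ × L + j * (A + A) ≤ L′
extend-repeatedly {L = L} A zero    C _    = L , C , ≤-reflexive (+-identityʳ L)
extend-repeatedly {L = L} A (suc j) C long with extend-repeatedly A j C long
... | L′ , C′ , L′≥ =
  L′ + (A + A) , extend-or-pad A C′ (≤-trans long (≤-trans (m≤m+n L _) L′≥)) ,
  subst (_≤ L′ + (A + A)) (identity L (A + A) (j * (A + A))) (+-monoˡ-≤ (A + A) L′≥)
  where
  identity : ∀ x y z → x + z + y ≡ x + (y + z)
  identity = solve-∀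

LongCode : ℕ → ℕ → ℕ → Set
LongCode D K A = ∃[ L ] Code D K L × A * (K + K) ≤ L

double : ∀ {D K A} → LongCode D K A → LongCode (K + D) K (2 * A)
double {D} {K} {A} (L , C , long) with extend-repeatedly A K C long
... | L′ , C′ , L′≥ =
  L′ , C′ , ≤-trans (≤-reflexive (identity A K)) (≤-trans (+-monoˡ-≤ _ long) L′≥)
  where
  identity : ∀ A K → 2 * A * (K + K) ≡ A * (K + K) + K * (A + A)
  identity = solve-∀

doubles : ∀ {D K A} i → LongCode D K A → LongCode (i * K + D) K (2 ^ i * A)
doubles {A = A} zero C = subst (LongCode _ _) (sym (*-identityˡ A)) C
doubles {D} {K} {A} (suc i) C =
  subst₂ (λ D′ A′ → LongCode D′ K A′) (sym (+-assoc K (i * K) D)) (sym (*-assoc 2 (2 ^ i) A))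
         (double {A = 2 ^ i * A} (doubles {A = A} i C))

stretch : ∀ {D K A} → K ≤ A → ∀ j → LongCode D K A → LongCode (j + D) K (j + A)
stretch {D} {K} {A} K≤A j (L , C , long) with extend-repeatedly A j C long
... | L′ , C′ , L′≥ = L′ , C′ , (begin
  (j + A) * (K + K)            ≡⟨ *-distribʳ-+ (K + K) j A ⟩
  j * (K + K) + A * (K + K)    ≤⟨ +-mono-≤ (*-monoʳ-≤ j (+-mono-≤ K≤A K≤A)) long ⟩
  j * (A + A) + L              ≡⟨ +-comm (j * (A + A)) L ⟩
  L + j * (A + A)              ≤⟨ L′≥ ⟩
  L′                           ∎)
  where open ≤-Reasoning

quadratic≤exponential : ∀ k → k * (k + 3) + 4 ≤ 2 ^ (k + 2)
quadratic≤exponential zero    = ≤-refl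
quadratic≤exponential (suc k) = begin
  suc k * (suc k + 3) + 4                  ≤⟨ m≤m+n _ (k * k + k) ⟩
  suc k * (suc k + 3) + 4 + (k * k + k)    ≡⟨ identity k ⟩
  2 * (k * (k + 3) + 4)                    ≤⟨ *-monoʳ-≤ 2 (quadratic≤exponential k) ⟩
  2 * 2 ^ (k + 2)                          ∎
  where
  open ≤-Reasoning
  identity : ∀ k → suc k * (suc k + 3) + 4 + (k * k + k) ≡ 2 * (k * (k + 3) + 4)
  identity = solve-∀

-- Doubling k+2 times from the isometric 2k-cycle reaches A = 2^(k+2) ≥ k(k+3) in dimension
-- k(k+3); from there on each new dimension adds at least 2k to the length.
long-code : ∀ k d → 1 ≤ k → k * (k + 3) ≤ d → LongCode d k d
long-code (suc N) d _ D₁≤d = shrink (stretch {A = A} k≤A (d ∸ D₁) (doubles {A = 1} (k + 2) base))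
  where
  k = suc N
  D₁ = k * (k + 3)
  A = 2 ^ (k + 2) * 1
  base : LongCode k k 1
  base = k + k , weaken (m≤m+n k k) (isometric N) , ≤-reflexive (*-identityˡ (k + k))
  D₁≤A : D₁ ≤ A
  D₁≤A = ≤-trans (m≤m+n D₁ 4)
                 (≤-trans (quadratic≤exponential k) (≤-reflexive (sym (*-identityʳ _))))
  k≤A : k ≤ A
  k≤A = ≤-trans (m≤m*n k (k + 3)) D₁≤A
  dimension≡d : d ∸ D₁ + ((k + 2) * k + k) ≡ d
  dimension≡d = trans (cong (d ∸ D₁ +_) (identity k)) (m∸n+n≡m D₁≤d)
    where
    identity : ∀ k → (k + 2) * k + k ≡ k * (k + 3)
    identity = solve-∀
  d≤ : d ≤ d ∸ D₁ + A
  d≤ = subst (_≤ d ∸ D₁ + A) (m∸n+n≡m D₁≤d) (+-monoʳ-≤ (d ∸ D₁) D₁≤A)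
  shrink : LongCode (d ∸ D₁ + ((k + 2) * k + k)) k (d ∸ D₁ + A) → LongCode d k d
  shrink (L , C , long) =
    L , subst (λ D → Code D k L) dimension≡d C , ≤-trans (*-monoˡ-≤ (k + k) d≤) long

mod-distance : ∀ {n} .{{_ : NonZero n}} i a → a ≤ n →
               ∣ i % n - (i + a) % n ∣ ≡ a ⊎ ∣ i % n - (i + a) % n ∣ ≡ n ∸ a
mod-distance {n} i a a≤n = cases (r + a <? n)
  where
  r = i % n
  shift-mod : (i + a) % n ≡ (r + a) % n
  shift-mod = begin
    (i + a) % n              ≡⟨ %-distribˡ-+ i a n ⟩
    (r + a % n) % n          ≡⟨ cong (λ x → (x + a % n) % n) (m%n%n≡m%n i n) ⟨
    (r % n + a % n) % n      ≡⟨ %-distribˡ-+ r a n ⟨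
    (r + a) % n              ∎
    where open ≡-Reasoning
  cases : Dec (r + a < n) → ∣ r - (i + a) % n ∣ ≡ a ⊎ ∣ r - (i + a) % n ∣ ≡ n ∸ a
  cases (yes r+a<n) =
    inj₁ (trans (cong (∣_-_∣ r) (trans shift-mod (m<n⇒m%n≡m r+a<n))) (∣m-m+n∣≡n r a))
  cases (no r+a≮n) = inj₂ (begin
    ∣ r - (i + a) % n ∣   ≡⟨ cong (∣_-_∣ r) (trans shift-mod (cong (_% n) (sym x+n≡r+a))) ⟩
    ∣ r - (x + n) % n ∣   ≡⟨ cong (∣_-_∣ r) (trans ([m+n]%n≡m%n x n) (m<n⇒m%n≡m x<n)) ⟩
    ∣ r - x ∣                    ≡⟨ cong (λ y → ∣ y - x ∣) r≡x+[n∸a] ⟩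
    ∣ x + (n ∸ a) - x ∣          ≡⟨ ∣-∣-comm (x + (n ∸ a)) x ⟩
    ∣ x - x + (n ∸ a) ∣          ≡⟨ ∣m-m+n∣≡n x (n ∸ a) ⟩
    n ∸ a                        ∎)
    where
    open ≡-Reasoning
    x = r + a ∸ n
    x+n≡r+a : x + n ≡ r + a
    x+n≡r+a = m∸n+n≡m (≮⇒≥ r+a≮n)
    x<n : x < n
    x<n = +-cancelʳ-< n x n (subst (_< n + n) (sym x+n≡r+a) (+-mono-<-≤ (m%n<n i n) a≤n))
    r≡x+[n∸a] : r ≡ x + (n ∸ a)
    r≡x+[n∸a] = +-cancelʳ-≡ a r (x + (n ∸ a)) (begin
      r + a              ≡⟨ x+n≡r+a ⟨
      x + n              ≡⟨ cong (x +_) (m∸n+n≡m a≤n) ⟨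
      x + (n ∸ a + a)    ≡⟨ +-assoc x (n ∸ a) a ⟨
      x + (n ∸ a) + a    ∎)

toℕ-mod : ∀ i n .{{_ : NonZero n}} → toℕ (i mod n) ≡ i % n
toℕ-mod i n = toℕ-fromℕ< (m%n<n i n)

cycDist-mod : ∀ {n} .{{_ : NonZero n}} i a → a ≤ n →
              cycDist (i mod n) ((i + a) mod n) ≡ a ⊓ (n ∸ a)
cycDist-mod {n} i a a≤n =
  trans (cong (λ x → x ⊓ (n ∸ x)) (cong₂ ∣_-_∣ (toℕ-mod i n) (toℕ-mod (i + a) n)))
        (by-cases (mod-distance i a a≤n))
  where
  by-cases : ∀ {x} → x ≡ a ⊎ x ≡ n ∸ a → x ⊓ (n ∸ x) ≡ a ⊓ (n ∸ a)
  by-cases (inj₁ refl) = refl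
  by-cases (inj₂ refl) = trans (cong ((n ∸ a) ⊓_) (m∸[m∸n]≡n a≤n)) (⊓-comm (n ∸ a) a)

fromCircuitCode : ∀ {d k n} .{{_ : NonZero n}} {c : Fin n → Vertex d} →
                  IsCircuitCode d k n c → Code d k n
fromCircuitCode {d} {k} {n} {c} ((3≤n , _ , consecutive) , sp) = record
  { walk     = walk
  ; periodic = λ p → cong c (toℕ-injective (begin
      toℕ ((n + p) mod n)  ≡⟨ toℕ-mod (n + p) n ⟩
      (n + p) % n          ≡⟨ cong (_% n) (+-comm n p) ⟩
      (p + n) % n          ≡⟨ [m+n]%n≡m%n p n ⟩
      p % n                ≡⟨ toℕ-mod p n ⟨
      toℕ (p mod n)        ∎))
  ; adjacent = λ p → subst (λ q → hamming (walk p) (walk q) ≡ 1) (+-comm p 1)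
      (consecutive (p mod n) ((p + 1) mod n) (trans (cycDist-mod p 1 1≤n) 1⊓[n∸1]≡1))
  ; spread   = λ i a a≤n → subst (λ x → x ⊓ k ≤ hamming (walk i) (walk (i + a)))
                                 (cycDist-mod i a a≤n) (sp (i mod n) ((i + a) mod n))
  }
  where
  open ≡-Reasoning
  walk : ℕ → Vertex d
  walk p = c (p mod n)
  1≤n : 1 ≤ n
  1≤n = ≤-trans (s≤s z≤n) 3≤n
  1⊓[n∸1]≡1 : 1 ⊓ (n ∸ 1) ≡ 1
  1⊓[n∸1]≡1 = m≤n⇒m⊓n≡m (∸-monoˡ-≤ 1 (≤-trans (s≤s (s≤s z≤n)) 3≤n))

m⊓n≤0⇒m≡0 : ∀ m {n} → 0 < n → m ⊓ n ≤ 0 → m ≡ 0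
m⊓n≤0⇒m≡0 zero    _         _ = refl
m⊓n≤0⇒m≡0 (suc m) {suc n} _ ()

wlog-≤ : ∀ {m} (P : Fin m → Fin m → Set) → (∀ {i j} → P i j → P j i) →
         (∀ i j → toℕ i ≤ toℕ j → P i j) → ∀ i j → P i j
wlog-≤ P sym-P ordered i j with ≤-total (toℕ i) (toℕ j)
... | inj₁ i≤j = ordered i j i≤j
... | inj₂ j≤i = sym-P (ordered j i j≤i)

toCircuitCode : ∀ {D K m} → 3 ≤ m → 1 ≤ K → Code D K m → ∃[ c ] IsCircuitCode D K m c
toCircuitCode {D} {K} {m} 3≤m 1≤K C =
  c , (3≤m , injective _ _ , wlog-≤ Adjacent adjacent-sym adjacent-≤) , wlog-≤ Spread spread-sym spread-≤
  where
  open Code C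
  c : Fin m → Vertex D
  c i = walk (toℕ i)

  cycDist-sym : ∀ (i j : Fin m) → cycDist i j ≡ cycDist j i
  cycDist-sym i j = cong (λ x → x ⊓ (m ∸ x)) (∣-∣-comm (toℕ i) (toℕ j))

  Spread Adjacent : Fin m → Fin m → Set
  Spread i j = cycDist i j ⊓ K ≤ hamming (c i) (c j)
  Adjacent i j = cycDist i j ≡ 1 → hamming (c i) (c j) ≡ 1

  spread-sym : ∀ {i j} → Spread i j → Spread j i
  spread-sym {i} {j} = subst₂ (λ x y → x ⊓ K ≤ y) (cycDist-sym i j) (hamming-sym (c i) (c j))

  adjacent-sym : ∀ {i j} → Adjacent i j → Adjacent j i
  adjacent-sym {i} {j} adj cd≡1 = trans (hamming-sym (c j) (c i)) (adj (trans (cycDist-sym i j) cd≡1))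

  module Ordered (i j : Fin m) (i≤j : toℕ i ≤ toℕ j) where
    a = toℕ j ∸ toℕ i
    j≡i+a : toℕ j ≡ toℕ i + a
    j≡i+a = sym (m+[n∸m]≡n i≤j)
    a≤m : a ≤ m
    a≤m = ≤-trans (m∸n≤m (toℕ j) (toℕ i)) (<⇒≤ (toℕ<n j))
    cycDist≡ : cycDist i j ≡ a ⊓ (m ∸ a)
    cycDist≡ = cong (λ x → x ⊓ (m ∸ x)) (m≤n⇒∣m-n∣≡n∸m i≤j)

  spread-≤ : ∀ i j → toℕ i ≤ toℕ j → Spread i j
  spread-≤ i j i≤j = subst₂ (λ x y → x ⊓ K ≤ hamming (c i) (walk y)) (sym cycDist≡) (sym j≡i+a)
                            (spread (toℕ i) a a≤m)
    where open Ordered i j i≤j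

  -- Cycle distance 1 means j = i + 1, or i = 0 and j = m - 1 across the wrap-around.
  adjacent-≤ : ∀ i j → toℕ i ≤ toℕ j → Adjacent i j
  adjacent-≤ i j i≤j cd≡1 with ⊓-sel a (m ∸ a)
    where open Ordered i j i≤j
  ... | inj₁ min≡a = subst (λ y → hamming (c i) (walk y) ≡ 1)
    (trans (+-comm 1 (toℕ i)) (trans (cong (toℕ i +_) 1≡a) (sym j≡i+a))) (adjacent (toℕ i))
    where
    open Ordered i j i≤j
    1≡a : 1 ≡ a
    1≡a = trans (sym cd≡1) (trans cycDist≡ min≡a)
  ... | inj₂ min≡m∸a = subst₂ (λ x y → hamming (walk x) (walk y) ≡ 1) (sym i≡0) (sym j≡a) wrap
    where
    open Ordered i j i≤j
    m≡1+a : m ≡ suc a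
    m≡1+a = trans (sym (m∸n+n≡m a≤m))
                  (cong (_+ a) (trans (sym min≡m∸a) (trans (sym cycDist≡) cd≡1)))
    i≡0 : toℕ i ≡ 0
    i≡0 = n≤0⇒n≡0 (+-cancelʳ-≤ a (toℕ i) 0 (s≤s⁻¹ (subst₂ _<_ j≡i+a m≡1+a (toℕ<n j))))
    j≡a : toℕ j ≡ a
    j≡a = trans j≡i+a (cong (_+ a) i≡0)
    wrap : hamming (walk 0) (walk a) ≡ 1
    wrap = begin
      hamming (walk 0) (walk a)        ≡⟨ cong (λ x → hamming x (walk a)) (periodic 0) ⟨
      hamming (walk (m + 0)) (walk a)
        ≡⟨ cong (λ x → hamming (walk x) (walk a)) (trans (+-identityʳ m) m≡1+a) ⟩
      hamming (walk (suc a)) (walk a)  ≡⟨ hamming-sym (walk (suc a)) (walk a) ⟩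
      hamming (walk a) (walk (suc a))  ≡⟨ adjacent a ⟩
      1                                ∎
      where open ≡-Reasoning

  injective : ∀ i j → c i ≡ c j → i ≡ j
  injective i j ci≡cj =
    toℕ-injective (∣m-n∣≡0⇒m≡n (m⊓n≤0⇒m≡0 x (m<n⇒0<n∸m x<m) cycDist≤0))
    where
    x = ∣ toℕ i - toℕ j ∣
    x<m : x < m
    x<m = ≤-<-trans (∣m-n∣≤m⊔n (toℕ i) (toℕ j)) (⊔-lub (toℕ<n i) (toℕ<n j))
    hamming≡0 : hamming (c i) (c j) ≡ 0
    hamming≡0 = trans (cong (hamming (c i)) (sym ci≡cj)) (hamming-refl (c i))
    cycDist≤0 : cycDist i j ≤ 0
    cycDist≤0 = ≤-reflexive (m⊓n≤0⇒m≡0 (cycDist i j) 1≤K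
                  (subst (cycDist i j ⊓ K ≤_) hamming≡0 (wlog-≤ Spread spread-sym spread-≤ i j)))

round-up-to-multiple : ∀ s → 1 ≤ s → ∀ h → ∃[ q ] q < s × s ∣ h + q
round-up-to-multiple s 1≤s zero = 0 , 1≤s , divides 0 refl
round-up-to-multiple s 1≤s (suc h) with round-up-to-multiple s 1≤s h
... | suc q , q<s , s∣h+q = q , <-trans (n<1+n q) q<s , subst (s ∣_) (+-suc h q) s∣h+q
... | zero  , _   , s∣h+0 = s ∸ 1 , ∸-monoʳ-< {s} {1} {0} (s≤s z≤n) 1≤s ,
                            subst (s ∣_) h+0+s≡1+h+[s∸1] (∣m∣n⇒∣m+n s∣h+0 ∣-refl)
  where
  h+0+s≡1+h+[s∸1] : h + 0 + s ≡ suc h + (s ∸ 1)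
  h+0+s≡1+h+[s∸1] = begin
    h + 0 + s            ≡⟨ cong (_+ s) (+-identityʳ h) ⟩
    h + s                ≡⟨ cong (h +_) (m+[n∸m]≡n 1≤s) ⟨
    h + (1 + (s ∸ 1))    ≡⟨ +-suc h (s ∸ 1) ⟩
    suc h + (s ∸ 1)      ∎
    where open ≡-Reasoning

lengthen-to-multiple : ∀ {D K L} s → 1 ≤ s → Code D K L → s * (K + K) ≤ L →
                       ∃[ m ] Code (suc D) K m × s ∣ m × L ≤ m
lengthen-to-multiple {K = K} s 1≤s C long with length-even C
... | h , refl with round-up-to-multiple s 1≤s h
... | q , q<s , s∣h+q =
  h + h + (q + q) , extend-or-pad q C (≤-trans (*-monoˡ-≤ (K + K) (<⇒≤ q<s)) long) ,
  subst (s ∣_) (identity h q) (∣m∣n⇒∣m+n s∣h+q s∣h+q) , m≤m+n (h + h) (q + q)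
  where
  identity : ∀ h q → h + q + (h + q) ≡ h + h + (q + q)
  identity = solve-∀

long-enough : ∀ {d k n} s → 1 ≤ k → k * (k + 3) ≤ d → s ≤ d → Code d k n →
              ∃[ L ] Code d k L × s * (k + k) ≤ L × n ≤ L
long-enough {d} {k} {n} s 1≤k D₁≤d s≤d C with s * (k + k) ≤? n
... | yes long  = n , C , long , ≤-refl
... | no  short with long-code k d 1≤k D₁≤d
... | L , B , dk≤L = L , B , sk≤L , ≤-trans (<⇒≤ (≰⇒> short)) sk≤L
  where
  sk≤L : s * (k + k) ≤ L
  sk≤L = ≤-trans (*-monoˡ-≤ (k + k) s≤d) dk≤L

lemma2 : (k d s : ℕ) → 2 ≤ k → (k + 2) * (k + 2) ≤ d → k ≤ s → s ≤ d →
    (n : ℕ) (c : Fin n → Vertex d) → IsCircuitCode d k n c →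
    Σ ℕ (λ m → Σ (Fin m → Vertex (d + 1)) (λ c′ →
    IsCircuitCode (d + 1) k m c′ × s ∣ m × n ≤ m))
lemma2 k d s 2≤k sq≤d k≤s s≤d zero c ((() , _) , _)
lemma2 k d s 2≤k sq≤d k≤s s≤d n@(suc _) c cc@((3≤n , _) , _) =
  let L , B , long , n≤L = long-enough s 1≤k D₁≤d s≤d (fromCircuitCode cc)
      m , C , s∣m , L≤m  = lengthen-to-multiple s (≤-trans 1≤k k≤s) B long
      n≤m                = ≤-trans n≤L L≤m
      c′ , is-code       = toCircuitCode (≤-trans 3≤n n≤m) 1≤k
                                         (subst (λ D → Code D k m) (+-comm 1 d) C)
  in m , c′ , is-code , s∣m , n≤m
  where
  1≤k : 1 ≤ k
  1≤k = ≤-trans (s≤s z≤n) 2≤k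
  D₁≤d : k * (k + 3) ≤ d
  D₁≤d = ≤-trans (subst (k * (k + 3) ≤_) (identity k) (m≤m+n _ (k + 4))) sq≤d
    where
    identity : ∀ k → k * (k + 3) + (k + 4) ≡ (k + 2) * (k + 2)
    identity = solve-∀
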